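{- Let $G$ be a connected graph and let $x$ be an extreme of $G$. Let $C$ be a component of $G-N[x]$ of maximum cardinality (so $G-N[x]$ is assumed nonempty), and let $X=V(G)\setminus(N(C)\cup C)$, where $N(C)$ is the set of vertices outside $C$ having a neighbor in $C$. Then every vertex of $X$ is an extreme of $G$.
   Context: For a vertex $v$ of a connected graph $G$, let $m(v)$ be the maximum cardinality of a component of $G-N[v]$ ($0$ if $G-N[v]$ is empty), where $N[v]$ is the closed neighborhood. A vertex $x$ is an extreme of $G$ if $m(x)=\max_{v\in V(G)} m(v)$. -}

module Defs where

open import Data.Nat using (ℕ; _≤_)
open import Data.Fin using (Fin; _≟_)
open import Data.Bool using (Bool; true; false; T; not; _∨_)
open import Data.Fin.Subset using (Subset; _∈_; _∉_; _⊆_; ∣_∣; Nonempty; ⊤)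
open import Data.Vec using (tabulate)
open import Data.Product using (Σ; _×_; ∃)
open import Data.Sum using (_⊎_)
open import Relation.Nullary using (does)
open import Relation.Binary.PropositionalEquality using (_≡_)

record Graph (n : ℕ) : Set where
  field
    adj    : Fin n → Fin n → Bool
    sym    : ∀ u v → adj u v ≡ adj v u
    irrefl : ∀ v → adj v v ≡ false

open Graph public

Adj : ∀ {n} → Graph n → Fin n → Fin n → Set
Adj G u v = T (adj G u v)

data Path {n} (G : Graph n) (S : Subset n) : Fin n → Fin n → Set where
  here : ∀ {u} → u ∈ S → Path G S u u
  step : ∀ {u v w} → u ∈ S → Adj G u v → Path G S v w → Path G S u w

Connected : ∀ {n} → Graph n → Set
Connected {n} G = ∀ (u v : Fin n) → Path G ⊤ u v

-- Vertex set of G - N[v]: vertices that are neither v nor adjacent to v.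
outsideClosedNbhd : ∀ {n} → Graph n → Fin n → Subset n
outsideClosedNbhd G v = tabulate (λ u → not (does (u ≟ v) ∨ adj G v u))

IsComponent : ∀ {n} → Graph n → Subset n → Subset n → Set
IsComponent G S C =
  Nonempty C × C ⊆ S
  × (∀ {u v} → u ∈ C → v ∈ C → Path G C u v)
  × (∀ {u w} → u ∈ C → w ∈ S → Adj G u w → w ∈ C)

-- HasM G v k  :  m(v) = k, i.e. k is the maximum cardinality of a component
-- of G - N[v], and k = 0 if there is no component (G - N[v] empty).
HasM : ∀ {n} → Graph n → Fin n → ℕ → Set
HasM G v k =
  (∀ C → IsComponent G (outsideClosedNbhd G v) C → ∣ C ∣ ≤ k)
  × (k ≡ 0 ⊎ Σ _ (λ C → IsComponent G (outsideClosedNbhd G v) C × ∣ C ∣ ≡ k))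

Extreme : ∀ {n} → Graph n → Fin n → Set
Extreme {n} G x = ∃ λ k → HasM G x k × (∀ (v : Fin n) k' → HasM G v k' → k' ≤ k)

module Submission where

-- Let m(v) denote the size of a largest component of G - N[v].  Since
-- y is neither in C nor adjacent to any vertex of C, the set C lies inside
-- G - N[y]; being connected, it lies inside a single component of G - N[y],
-- so  m(x) = |C| ≤ m(y).  As x is an extreme, m(v) ≤ m(x) ≤ m(y) for all v,
-- i.e. y is an extreme as well.
--
-- The only real work is constructive: "m(y)" has to be shown to exist.
-- Then every connected nonempty subset of G - N[v] has size at most m(v), and
-- the theorem is a short consequence.

open import Defs
open import Data.Nat using (ℕ; zero; suc; _≤_; _<_; _+_; z≤n; s≤s)
open import Data.Nat.Properties
  using (≤-refl; ≤-trans; ≤-totalOrder; module ≤-Reasoning; m≤m+n; <-≤-trans; <-irrefl; +-suc; +-monoʳ-≤)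
open import Data.Fin using (Fin; _≟_)
open import Data.Fin.Properties using (any?)
open import Data.Fin.Subset using (Subset; _∈_; _∉_; _⊆_; _∪_; ∣_∣; Nonempty; ⁅_⁆)
open import Data.Fin.Subset.Properties
  using (_∈?_; p⊆q⇒∣p∣≤∣q∣; p⊂q⇒∣p∣<∣q∣; ∣p∣≤n; x∈⁅x⁆; x∈⁅y⁆⇒x≡y;
         p⊆p∪q; x∈p∪q⁻; x∈p∪q⁺)
open import Data.Vec using (tabulate)
open import Data.Vec.Properties using ([]=⇒lookup; lookup⇒[]=; lookup∘tabulate)
open import Data.Bool using (Bool; true; false; T; not; _∨_)
open import Data.Bool.Properties using (T?)
open import Data.List using (List; map; allFin)
open import Data.List.Membership.Propositional using () renaming (_∈_ to _∈ˡ_)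
open import Data.List.Membership.Propositional.Properties using (∈-map⁺; ∈-map⁻; ∈-allFin)
open import Data.List.Relation.Unary.All using (lookup)
open import Data.List.Extrema ≤-totalOrder using (max; xs≤max; argmax-sel)
open import Data.Product using (Σ; _×_; ∃; _,_; proj₁; proj₂)
open import Data.Sum using (_⊎_; inj₁; inj₂; [_,_]; [_,_]′)
open import Data.Empty using (⊥-elim)
open import Relation.Nullary using (¬_; Dec; does; yes; no)
open import Relation.Nullary.Decidable using (_×-dec_; ¬?)
open import Level using (0ℓ)
open import Relation.Unary using (Pred; Decidable)
open import Relation.Binary.PropositionalEquality
  using (_≡_; refl; trans; subst) renaming (sym to ≡-sym)

∈-tabulate⁻ : ∀ {n} (f : Fin n → Bool) {w} → w ∈ tabulate f → f w ≡ true
∈-tabulate⁻ f {w} w∈ = trans (≡-sym (lookup∘tabulate f w)) ([]=⇒lookup w∈)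

∈-tabulate⁺ : ∀ {n} (f : Fin n → Bool) {w} → f w ≡ true → w ∈ tabulate f
∈-tabulate⁺ f {w} fw = lookup⇒[]= w (tabulate f) (trans (lookup∘tabulate f w) fw)

select : ∀ {n} {P : Pred (Fin n) 0ℓ} → Decidable P → Subset n
select P? = tabulate (λ w → does (P? w))

∈-select⁺ : ∀ {n} {P : Pred (Fin n) 0ℓ} (P? : Decidable P) {w} → P w → w ∈ select P?
∈-select⁺ P? {w} Pw = ∈-tabulate⁺ (λ v → does (P? v)) does-true
  where
  does-true : does (P? w) ≡ true
  does-true with P? w
  ... | yes _  = refl
  ... | no ¬Pw = ⊥-elim (¬Pw Pw)

∈-select⁻ : ∀ {n} {P : Pred (Fin n) 0ℓ} (P? : Decidable P) {w} → w ∈ select P? → P w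
∈-select⁻ P? {w} w∈ with P? w | ∈-tabulate⁻ (λ v → does (P? v)) w∈
... | yes Pw | _ = Pw
... | no _   | ()

module _ {n} {G : Graph n} where

  widen : ∀ {A B : Subset n} {u v} → A ⊆ B → Path G A u v → Path G B u v
  widen A⊆B (here u∈A)      = here (A⊆B u∈A)
  widen A⊆B (step u∈A e p) = step (A⊆B u∈A) e (widen A⊆B p)

  source∈ : ∀ {A : Subset n} {u v} → Path G A u v → u ∈ A
  source∈ (here u∈A)     = u∈A
  source∈ (step u∈A _ _) = u∈A

  snoc : ∀ {A : Subset n} {u v w} → Path G A u v → Adj G v w → w ∈ A → Path G A u w
  snoc (here u∈A)      e w∈A = step u∈A e (here w∈A)
  snoc (step u∈A e' p) e w∈A = step u∈A e' (snoc p e w∈A)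

  reverse : ∀ {A : Subset n} {u v} → Path G A u v → Path G A v u
  reverse (here u∈A)     = here u∈A
  reverse (step u∈A e p) = snoc (reverse p) (subst T (Defs.sym G _ _) e) u∈A

  _++ᵖ_ : ∀ {A : Subset n} {u v w} → Path G A u v → Path G A v w → Path G A u w
  here _       ++ᵖ q = q
  step u∈A e p ++ᵖ q = step u∈A e (p ++ᵖ q)

InternallyConnected : ∀ {n} → Graph n → Subset n → Set
InternallyConnected G D = ∀ {u v} → u ∈ D → v ∈ D → Path G D u v

module ComponentOf {n} (G : Graph n) (S : Subset n) where

  Frontier : Subset n → Pred (Fin n) 0ℓ
  Frontier R w = w ∈ S × ∃ λ v → v ∈ R × Adj G v w

  frontier? : ∀ R → Decidable (Frontier R)
  frontier? R w = (w ∈? S) ×-dec any? (λ v → (v ∈? R) ×-dec T? (adj G v w))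

  expand : Subset n → Subset n
  expand R = R ∪ select (frontier? R)

  ⊆-expand : ∀ R → R ⊆ expand R
  ⊆-expand R = p⊆p∪q _

  frontier⊆expand : ∀ R {w} → Frontier R w → w ∈ expand R
  frontier⊆expand R Fw = x∈p∪q⁺ (inj₂ (∈-select⁺ (frontier? R) Fw))

  expand⁻ : ∀ R {w} → w ∈ expand R → w ∈ R ⊎ Frontier R w
  expand⁻ R w∈ with x∈p∪q⁻ R _ w∈
  ... | inj₁ w∈R = inj₁ w∈R
  ... | inj₂ w∈F = inj₂ (∈-select⁻ (frontier? R) w∈F)

  Grows : Subset n → Set
  Grows R = ∃ λ w → w ∈ expand R × w ∉ R

  grows? : ∀ R → Dec (Grows R)
  grows? R = any? (λ w → (w ∈? expand R) ×-dec ¬? (w ∈? R))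

  saturate : ℕ → Subset n → Subset n
  saturate zero    R = R
  saturate (suc k) R with grows? R
  ... | yes _ = saturate k (expand R)
  ... | no _  = R

  saturate-preserves : (P : Subset n → Set) → (∀ R → P R → P (expand R))
                     → ∀ k R → P R → P (saturate k R)
  saturate-preserves P pres zero    R PR = PR
  saturate-preserves P pres (suc k) R PR with grows? R
  ... | yes _ = saturate-preserves P pres k (expand R) (pres R PR)
  ... | no _  = PR

  -- Each growing step increases |R|, which is at most n; so enough fuel
  -- (k + |R| > n) guarantees that a fixpoint is reached.
  saturate-closed : ∀ k R → n < k + ∣ R ∣ → expand (saturate k R) ⊆ saturate k R
  saturate-closed zero R n<|R| = ⊥-elim (<-irrefl refl (<-≤-trans n<|R| (∣p∣≤n R)))
  saturate-closed (suc k) R n<fuel with grows? R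
  ... | yes (w , w∈ , w∉) = saturate-closed k (expand R)
          (<-≤-trans n<fuel (subst (_≤ k + ∣ expand R ∣) (+-suc k ∣ R ∣)
             (+-monoʳ-≤ k (p⊂q⇒∣p∣<∣q∣ (⊆-expand R , w , w∈ , w∉)))))
  ... | no stable = λ w∈ → closed _ w∈
    where
    closed : ∀ w → w ∈ expand R → w ∈ R
    closed w w∈ with w ∈? R
    ... | yes w∈R = w∈R
    ... | no w∉R  = ⊥-elim (stable (w , w∈ , w∉R))

  component : Fin n → Subset n
  component u = saturate (suc n) ⁅ u ⁆

  component-closed : ∀ u → expand (component u) ⊆ component u
  component-closed u = saturate-closed (suc n) ⁅ u ⁆ (s≤s (m≤m+n n _))

  RootedAt : Fin n → Subset n → Set
  RootedAt u R = u ∈ R × R ⊆ S × (∀ {w} → w ∈ R → Path G R u w)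

  expand-rooted : ∀ u R → RootedAt u R → RootedAt u (expand R)
  expand-rooted u R (u∈R , R⊆S , reach) = ⊆-expand R u∈R , expand⊆S , reach′
    where
    expand⊆S : expand R ⊆ S
    expand⊆S w∈ = [ R⊆S , proj₁ ] (expand⁻ R w∈)
    reach′ : ∀ {w} → w ∈ expand R → Path G (expand R) u w
    reach′ w∈ with expand⁻ R w∈
    ... | inj₁ w∈R               = widen (⊆-expand R) (reach w∈R)
    ... | inj₂ (_ , v , v∈R , e) = snoc (widen (⊆-expand R) (reach v∈R)) e w∈

  singleton-rooted : ∀ u → u ∈ S → RootedAt u ⁅ u ⁆
  singleton-rooted u u∈S =
    x∈⁅x⁆ u ,
    (λ w∈ → subst (_∈ S) (≡-sym (x∈⁅y⁆⇒x≡y u w∈)) u∈S) ,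
    (λ w∈ → subst (Path G ⁅ u ⁆ u) (≡-sym (x∈⁅y⁆⇒x≡y u w∈)) (here (x∈⁅x⁆ u)))

  component-rooted : ∀ u → u ∈ S → RootedAt u (component u)
  component-rooted u u∈S =
    saturate-preserves (RootedAt u) (expand-rooted u) (suc n) ⁅ u ⁆ (singleton-rooted u u∈S)

  component-isComponent : ∀ u → u ∈ S → IsComponent G S (component u)
  component-isComponent u u∈S with component-rooted u u∈S
  ... | u∈K , K⊆S , reach =
    (u , u∈K) , K⊆S ,
    (λ a∈ b∈ → reverse (reach a∈) ++ᵖ reach b∈) ,
    (λ a∈ w∈S e → component-closed u (frontier⊆expand _ (w∈S , _ , a∈ , e)))

  walk-stays : ∀ u {D} → D ⊆ S → ∀ {a w} → Path G D a w → a ∈ component u → w ∈ component u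
  walk-stays u D⊆S (here _)     a∈ = a∈
  walk-stays u D⊆S (step _ e p) a∈ =
    walk-stays u D⊆S p (component-closed u (frontier⊆expand _ (D⊆S (source∈ p) , _ , a∈ , e)))

  connected⊆component : ∀ {D u} → D ⊆ S → InternallyConnected G D → u ∈ D
                      → u ∈ S → D ⊆ component u
  connected⊆component {u = u} D⊆S conn u∈D u∈S w∈D =
    walk-stays u D⊆S (conn u∈D w∈D) (proj₁ (component-rooted u u∈S))

maximum : ∀ n (g : Fin n → ℕ) → ∃ λ k → (∀ i → g i ≤ k) × (k ≡ 0 ⊎ ∃ λ i → g i ≡ k)
maximum n g = k , bound , attained (argmax-sel (λ x → x) 0 values)
  where
  values : List ℕ
  values = map g (allFin n)
  k : ℕ
  k = max 0 values
  bound : ∀ i → g i ≤ k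
  bound i = lookup (xs≤max 0 values) (∈-map⁺ g (∈-allFin i))
  attained : k ≡ 0 ⊎ k ∈ˡ values → k ≡ 0 ⊎ ∃ λ i → g i ≡ k
  attained (inj₁ k≡0) = inj₁ k≡0
  attained (inj₂ k∈)  with ∈-map⁻ g k∈
  ... | i , _ , k≡gi = inj₂ (i , ≡-sym k≡gi)

connected≤m : ∀ {n} (G : Graph n) v {k} → HasM G v k
            → ∀ {D} → D ⊆ outsideClosedNbhd G v → InternallyConnected G D → Nonempty D
            → ∣ D ∣ ≤ k
connected≤m G v (bound , _) D⊆S conn (u , u∈D) =
  ≤-trans (p⊆q⇒∣p∣≤∣q∣ (connected⊆component D⊆S conn u∈D (D⊆S u∈D)))
          (bound _ (component-isComponent u (D⊆S u∈D)))
  where open ComponentOf G (outsideClosedNbhd G v)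

-- m(v) exists: the largest size of the component of a vertex of G - N[v].
m-exists : ∀ {n} (G : Graph n) v → ∃ (HasM G v)
m-exists {n} G v = k , bound , attained
  where
  S : Subset n
  S = outsideClosedNbhd G v
  open ComponentOf G S
  componentSize : Fin n → ℕ
  componentSize u with u ∈? S
  ... | yes _ = ∣ component u ∣
  ... | no _  = 0
  component≤size : ∀ u → u ∈ S → ∣ component u ∣ ≤ componentSize u
  component≤size u u∈S with u ∈? S
  ... | yes _  = ≤-refl
  ... | no u∉S = ⊥-elim (u∉S u∈S)
  largest : ∃ λ k → (∀ i → componentSize i ≤ k) × (k ≡ 0 ⊎ ∃ λ i → componentSize i ≡ k)
  largest = maximum n componentSize
  k : ℕ
  k = proj₁ largest
  bound : ∀ C → IsComponent G S C → ∣ C ∣ ≤ k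
  bound C ((u , u∈C) , C⊆S , conn , _) = begin
    ∣ C ∣             ≤⟨ p⊆q⇒∣p∣≤∣q∣ (connected⊆component C⊆S conn u∈C (C⊆S u∈C)) ⟩
    ∣ component u ∣   ≤⟨ component≤size u (C⊆S u∈C) ⟩
    componentSize u   ≤⟨ proj₁ (proj₂ largest) u ⟩
    k                 ∎
    where open ≤-Reasoning
  fromVertex : ∀ i → componentSize i ≡ k → k ≡ 0 ⊎ Σ _ (λ C → IsComponent G S C × ∣ C ∣ ≡ k)
  fromVertex i size≡k with i ∈? S
  ... | yes i∈S = inj₂ (component i , component-isComponent i i∈S , size≡k)
  ... | no _    = inj₁ (≡-sym size≡k)
  attained : k ≡ 0 ⊎ Σ _ (λ C → IsComponent G S C × ∣ C ∣ ≡ k)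
  attained = [ inj₁ , (λ { (i , size≡k) → fromVertex i size≡k }) ]′ (proj₂ (proj₂ largest))

m≤largest : ∀ {n} (G : Graph n) v {k} → HasM G v k
          → (C : Subset n) → (∀ D → IsComponent G (outsideClosedNbhd G v) D → ∣ D ∣ ≤ ∣ C ∣)
          → k ≤ ∣ C ∣
m≤largest G v (_ , inj₁ refl)                 C C-largest = z≤n
m≤largest G v (_ , inj₂ (D , isComp , refl)) C C-largest = C-largest D isComp

avoiding⊆outside : ∀ {n} (G : Graph n) {y} {C : Subset n}
                 → y ∉ C → (∀ c → c ∈ C → ¬ Adj G y c) → C ⊆ outsideClosedNbhd G y
avoiding⊆outside G {y} y∉C nonadjacent {c} c∈C = ∈-tabulate⁺ _ outsideN[y]
  where
  outsideN[y] : not (does (c ≟ y) ∨ adj G y c) ≡ true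
  outsideN[y] with c ≟ y | adj G y c in adj≡
  ... | yes refl | _     = ⊥-elim (y∉C c∈C)
  ... | no _     | true  = ⊥-elim (nonadjacent c c∈C (subst T (≡-sym adj≡) _))
  ... | no _     | false = refl

mainTheorem4 : ∀ {n} (G : Graph n) → Connected G → (x : Fin n) → Extreme G x
    → (C : Subset n) → IsComponent G (outsideClosedNbhd G x) C
    → (∀ D → IsComponent G (outsideClosedNbhd G x) D → ∣ D ∣ ≤ ∣ C ∣)
    → (y : Fin n) → y ∉ C → (∀ c → c ∈ C → ¬ Adj G y c)
    → Extreme G y
mainTheorem4 G _ x (mx , hasMx , x-extreme) C (C-nonempty , _ , C-connected , _) C-largest
             y y∉C nonadjacent = my , hasMy , m≤my
  where
  my : ℕ
  my = proj₁ (m-exists G y)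
  hasMy : HasM G y my
  hasMy = proj₂ (m-exists G y)
  mx≤|C| : mx ≤ ∣ C ∣
  mx≤|C| = m≤largest G x hasMx C C-largest
  |C|≤my : ∣ C ∣ ≤ my
  |C|≤my = connected≤m G y hasMy (avoiding⊆outside G y∉C nonadjacent) C-connected C-nonempty
  m≤my : ∀ v k → HasM G v k → k ≤ my
  m≤my v k hasM = ≤-trans (x-extreme v k hasM) (≤-trans mx≤|C| |C|≤my)
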